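{- Let $k\ge1$. For every $(x,y,z)\in\mathcal{F}_k({\sf V})$ we have $w^{k+2}(x,y,z)=(z,y,x)$.
   Context: ${\sf V}$ is the poset with elements $c,\ell,r$ and relations $c<\ell$, $c<r$. $\mathcal{F}_k({\sf V})$ is the set of functions $f:{\sf V}\to\{0,\dots,k\}$ with $f(\ell)\le f(c)$ and $f(r)\le f(c)$, written as triples $(f(\ell),f(c),f(r))$. For $x\in{\sf V}$, the whirl $w_x$ repeatedly adds $1$ modulo $k+1$ to $f(x)$ (other values unchanged) until the result lies in $\mathcal{F}_k({\sf V})$. Whirling is $w=w_c\circ w_r\circ w_\ell$ (apply $w_\ell$, then $w_r$, then $w_c$). -}

module Defs where

open import Data.Nat using (ℕ; zero; suc; _≤ᵇ_)
open import Data.Nat.DivMod using (_%_)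
open import Data.Bool using (Bool; true; false; _∧_; if_then_else_)
open import Data.Product using (_×_; _,_)

-- A function f : V → {0..k} is stored as the triple (f ℓ , f c , f r).
Triple : Set
Triple = ℕ × ℕ × ℕ

inF : ℕ → Triple → Bool
inF k (a , b , c) = (a ≤ᵇ k) ∧ (b ≤ᵇ k) ∧ (c ≤ᵇ k) ∧ (a ≤ᵇ b) ∧ (c ≤ᵇ b)

data Elt : Set where
  ℓ c r : Elt

bump : ℕ → Elt → Triple → Triple
bump k ℓ (a , b , d) = (suc a % suc k , b , d)
bump k c (a , b , d) = (a , suc b % suc k , d)
bump k r (a , b , d) = (a , b , suc d % suc k)

-- repeatedly bump until the result lies in F_k(V), with fuel.
-- Starting from an element of F_k(V), k+1 bumps return to the start,
-- so fuel k+1 always suffices.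
bumpUntil : ℕ → ℕ → Elt → Triple → Triple
bumpUntil fuel    k x t with bump k x t
bumpUntil zero    k x t | t' = t'
bumpUntil (suc n) k x t | t' = if inF k t' then t' else bumpUntil n k x t'

whirlAt : ℕ → Elt → Triple → Triple
whirlAt k x t = bumpUntil k k x t

whirl : ℕ → Triple → Triple
whirl k t = whirlAt k c (whirlAt k r (whirlAt k ℓ t))

iterate : {A : Set} → (A → A) → ℕ → A → A
iterate f zero    a = a
iterate f (suc n) a = f (iterate f n a)

-- A summit is a state (T , T , L) with L ≤ T: ℓ sits on c.  For L < T write it as
-- peak low gap, so T = low + 1 + gap, and let room = k − T.  Whirling room + 1 times
-- (ℓ drops to 0, all three climb until c reaches k, then c falls onto r) yields the
-- mirror image of the summit with data (room , low , gap).  Three such rotations take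
-- (low + 1) + (gap + 1) + (room + 1) = k + 2 steps and restore the data, mirrored an
-- odd number of times.  The diagonal summits (m , m , m) and (k − m , k − m , k − m)
-- are carried to each other in k − m + 1 and m + 1 steps.  Every other state is
-- reached from a summit by whirling, which commutes with the mirror, so the property
-- spreads along orbits.
module Submission where

open import Defs
open import Data.Nat using (ℕ; zero; suc; _≤_; _<_; _+_; _⊔_; _≤ᵇ_; z≤n; s≤s; z<s)
open import Data.Nat.Properties
open import Data.Nat.DivMod using (_%_; m<n⇒m%n≡m; n%n≡0; m%n<n)
open import Data.Nat.Solver using (module +-*-Solver)
open import Data.Bool using (true; false; _∧_)
open import Data.Bool.Properties using (∧-comm; ∧-zeroʳ; ∧-conicalˡ; ∧-conicalʳ; ¬-not; T-≡)
open import Data.Product using (_×_; _,_)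
open import Data.Sum using (inj₁; inj₂)
open import Function using (_∘_; Equivalence)
open import Relation.Nullary using (yes; no; contradiction)
open import Relation.Binary.PropositionalEquality
open ≡-Reasoning

iterate-suc : ∀ {A : Set} (f : A → A) n x → iterate f (suc n) x ≡ iterate f n (f x)
iterate-suc f zero    x = refl
iterate-suc f (suc n) x = cong f (iterate-suc f n x)

iterate-+ : ∀ {A : Set} (f : A → A) m n x → iterate f (m + n) x ≡ iterate f m (iterate f n x)
iterate-+ f zero    n x = refl
iterate-+ f (suc m) n x = cong f (iterate-+ f m n x)

iterate-preserves : ∀ {A : Set} (P : A → Set) (f : A → A) →
                    (∀ {x} → P x → P (f x)) → ∀ n {x} → P x → P (iterate f n x)
iterate-preserves P f f-pres zero    px = px
iterate-preserves P f f-pres (suc n) px = f-pres (iterate-preserves P f f-pres n px)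

iterate-commute : ∀ {A : Set} (P : A → Set) (f g : A → A) →
                  (∀ {x} → P x → P (f x)) → (∀ {x} → P x → f (g x) ≡ g (f x)) →
                  ∀ n {x} → P x → iterate f n (g x) ≡ g (iterate f n x)
iterate-commute P f g f-pres comm zero    px = refl
iterate-commute P f g f-pres comm (suc n) px =
  trans (cong f (iterate-commute P f g f-pres comm n px))
        (comm (iterate-preserves P f f-pres n px))

InF : ℕ → Triple → Set
InF k (a , b , d) = a ≤ b × d ≤ b × b ≤ k

swap : Triple → Triple
swap (a , b , d) = (d , b , a)

swap-involutive : ∀ t → swap (swap t) ≡ t
swap-involutive (a , b , d) = refl

InF-swap : ∀ {k} t → InF k t → InF k (swap t)
InF-swap (a , b , d) (a≤b , d≤b , b≤k) = d≤b , a≤b , b≤k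

≤⇒≤ᵇ≡true : ∀ {m n} → m ≤ n → (m ≤ᵇ n) ≡ true
≤⇒≤ᵇ≡true = Equivalence.to T-≡ ∘ ≤⇒≤ᵇ

inF-true : ∀ {k} t → InF k t → inF k t ≡ true
inF-true (a , b , d) (a≤b , d≤b , b≤k)
  rewrite ≤⇒≤ᵇ≡true (≤-trans a≤b b≤k) | ≤⇒≤ᵇ≡true b≤k | ≤⇒≤ᵇ≡true (≤-trans d≤b b≤k)
        | ≤⇒≤ᵇ≡true a≤b | ≤⇒≤ᵇ≡true d≤b = refl

inF-false : ∀ {k} a b d → b < a ⊔ d → inF k (a , b , d) ≡ false
inF-false {k} a b d b<a⊔d = ¬-not λ member →
  let below = ∧-conicalʳ (d ≤ᵇ k) _ (∧-conicalʳ (b ≤ᵇ k) _ (∧-conicalʳ (a ≤ᵇ k) _ member))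
      a≤b   = ≤ᵇ⇒≤ a b (Equivalence.from T-≡ (∧-conicalˡ _ (d ≤ᵇ b) below))
      d≤b   = ≤ᵇ⇒≤ d b (Equivalence.from T-≡ (∧-conicalʳ (a ≤ᵇ b) _ below))
  in <⇒≱ b<a⊔d (⊔-lub a≤b d≤b)

inF-swap : ∀ k t → inF k (swap t) ≡ inF k t
inF-swap k (a , b , d) = exchange (a ≤ᵇ k) (b ≤ᵇ k) (d ≤ᵇ k) (a ≤ᵇ b) (d ≤ᵇ b)
  where
  exchange : ∀ x y z u v → z ∧ y ∧ x ∧ v ∧ u ≡ x ∧ y ∧ z ∧ u ∧ v
  exchange true  y true  u v = cong (y ∧_) (∧-comm v u)
  exchange true  y false u v = sym (∧-zeroʳ y)
  exchange false y true  u v = ∧-zeroʳ y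
  exchange false y false u v = refl

bumpUntil-hit : ∀ fuel {k x t u} → bump k x t ≡ u → inF k u ≡ true → bumpUntil fuel k x t ≡ u
bumpUntil-hit zero    refl _   = refl
bumpUntil-hit (suc _) refl hit rewrite hit = refl

bumpUntil-miss : ∀ fuel {k x t u} → bump k x t ≡ u → inF k u ≡ false →
                 bumpUntil (suc fuel) k x t ≡ bumpUntil fuel k x u
bumpUntil-miss fuel refl miss rewrite miss = refl

bumpUntil-mirror : ∀ fuel k t → bumpUntil fuel k r (swap t) ≡ swap (bumpUntil fuel k ℓ t)
bumpUntil-mirror zero       k (a , b , d) = refl
bumpUntil-mirror (suc fuel) k (a , b , d)
  rewrite inF-swap k (bump k ℓ (a , b , d)) with inF k (bump k ℓ (a , b , d))
... | true  = refl
... | false = bumpUntil-mirror fuel k (bump k ℓ (a , b , d))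

tick : ℕ → ℕ → ℕ
tick b a = suc a % suc b

tick-< : ∀ {a b} → a < b → tick b a ≡ suc a
tick-< a<b = m<n⇒m%n≡m (s≤s a<b)

tick-self : ∀ b → tick b b ≡ 0
tick-self b = n%n≡0 (suc b)

tick-≤ : ∀ b a → tick b a ≤ b
tick-≤ b a = ≤-pred (m%n<n (suc a) (suc b))

bumpUntil-ℓ-wraps : ∀ fuel {k a b d} → b ≤ a → a ≤ k → k ≤ fuel + a → d ≤ b →
                    bumpUntil fuel k ℓ (a , b , d) ≡ (0 , b , d)
bumpUntil-ℓ-wraps fuel {k} {b = b} {d} b≤a a≤k k≤fuel+a d≤b with m≤n⇒m<n∨m≡n a≤k
... | inj₂ refl =
  bumpUntil-hit fuel (cong (_, b , d) (n%n≡0 (suc k))) (inF-true (0 , b , d) (z≤n , d≤b , b≤a))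
bumpUntil-ℓ-wraps zero b≤a a≤k k≤a d≤b | inj₁ a<k = contradiction k≤a (<⇒≱ a<k)
bumpUntil-ℓ-wraps (suc fuel) {k} {a} {b} {d} b≤a a≤k k≤fuel+a d≤b | inj₁ a<k =
  trans (bumpUntil-miss fuel (cong (_, b , d) (m<n⇒m%n≡m (s≤s a<k)))
                        (inF-false {k} (suc a) b d (m<n⇒m<n⊔o d (s≤s b≤a))))
        (bumpUntil-ℓ-wraps fuel (m≤n⇒m≤1+n b≤a) a<k (subst (k ≤_) (sym (+-suc fuel a)) k≤fuel+a) d≤b)

bumpUntil-c-climbs : ∀ fuel {k a m d} t → bump k c t ≡ (a , m , d) → m ⊔ (a ⊔ d) ≤ k →
                     a ⊔ d ≤ fuel + m → bumpUntil fuel k c t ≡ (a , m ⊔ (a ⊔ d) , d)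
bumpUntil-c-climbs fuel {k} {a} {m} {d} t bumped top≤k enough with a ⊔ d ≤? m
... | yes a⊔d≤m =
  trans (bumpUntil-hit fuel bumped (inF-true (a , m , d) (≤-trans (m≤m⊔n a d) a⊔d≤m ,
                                                          ≤-trans (m≤n⊔m a d) a⊔d≤m ,
                                                          ≤-trans (m≤m⊔n m _) top≤k)))
        (cong (λ v → a , v , d) (sym (m≥n⇒m⊔n≡m a⊔d≤m)))
bumpUntil-c-climbs zero t bumped top≤k enough | no a⊔d≰m = contradiction enough a⊔d≰m
bumpUntil-c-climbs (suc fuel) {k} {a} {m} {d} t bumped top≤k enough | no a⊔d≰m = begin
    bumpUntil (suc fuel) k c t
  ≡⟨ bumpUntil-miss fuel bumped (inF-false {k} a m d m<a⊔d) ⟩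
    bumpUntil fuel k c (a , m , d)
  ≡⟨ bumpUntil-c-climbs fuel (a , m , d) (cong (λ v → a , v , d) (m<n⇒m%n≡m (s≤s 1+m≤k)))
                         (subst (_≤ k) (sym (m≤n⇒m⊔n≡n m<a⊔d)) a⊔d≤k)
                         (subst (a ⊔ d ≤_) (sym (+-suc fuel m)) enough) ⟩
    (a , suc m ⊔ (a ⊔ d) , d)
  ≡⟨ cong (λ v → a , v , d) (trans (m≤n⇒m⊔n≡n m<a⊔d) (sym (m≤n⇒m⊔n≡n (<⇒≤ m<a⊔d)))) ⟩
    (a , m ⊔ (a ⊔ d) , d)
  ∎
  where
  m<a⊔d : m < a ⊔ d
  m<a⊔d = ≰⇒> a⊔d≰m
  a⊔d≤k : a ⊔ d ≤ k
  a⊔d≤k = ≤-trans (m≤n⊔m m _) top≤k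
  1+m≤k : suc m ≤ k
  1+m≤k = ≤-trans m<a⊔d a⊔d≤k

whirlAt-ℓ : ∀ {k} a b d → InF k (a , b , d) → whirlAt k ℓ (a , b , d) ≡ (tick b a , b , d)
whirlAt-ℓ {k} a b d (a≤b , d≤b , b≤k) with m≤n⇒m<n∨m≡n a≤b
... | inj₁ a<b =
  trans (bumpUntil-hit k (cong (_, b , d) (m<n⇒m%n≡m (s≤s (≤-trans a<b b≤k))))
                         (inF-true (suc a , b , d) (a<b , d≤b , b≤k)))
        (cong (_, b , d) (sym (tick-< a<b)))
... | inj₂ refl =
  trans (bumpUntil-ℓ-wraps k ≤-refl b≤k (m≤m+n k a) d≤b) (cong (_, a , d) (sym (tick-self a)))

whirlAt-r : ∀ {k} a b d → InF k (a , b , d) → whirlAt k r (a , b , d) ≡ (a , b , tick b d)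
whirlAt-r {k} a b d inF =
  trans (bumpUntil-mirror k k (d , b , a)) (cong swap (whirlAt-ℓ d b a (InF-swap (a , b , d) inF)))

whirlAt-c : ∀ {k} a b d → InF k (a , b , d) → whirlAt k c (a , b , d) ≡ (a , tick k b ⊔ (a ⊔ d) , d)
whirlAt-c {k} a b d (a≤b , d≤b , b≤k) =
  bumpUntil-c-climbs k (a , b , d) refl (⊔-lub (tick-≤ k b) a⊔d≤k) (≤-trans a⊔d≤k (m≤m+n k _))
  where
  a⊔d≤k : a ⊔ d ≤ k
  a⊔d≤k = ≤-trans (⊔-lub a≤b d≤b) b≤k

whirl-formula : ∀ {k} a b d → InF k (a , b , d) →
                whirl k (a , b , d) ≡ (tick b a , tick k b ⊔ (tick b a ⊔ tick b d) , tick b d)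
whirl-formula {k} a b d inF@(a≤b , d≤b , b≤k) = begin
    whirlAt k c (whirlAt k r (whirlAt k ℓ (a , b , d)))
  ≡⟨ cong (whirlAt k c ∘ whirlAt k r) (whirlAt-ℓ a b d inF) ⟩
    whirlAt k c (whirlAt k r (tick b a , b , d))
  ≡⟨ cong (whirlAt k c) (whirlAt-r (tick b a) b d (tick-≤ b a , d≤b , b≤k)) ⟩
    whirlAt k c (tick b a , b , tick b d)
  ≡⟨ whirlAt-c (tick b a) b (tick b d) (tick-≤ b a , tick-≤ b d , b≤k) ⟩
    (tick b a , tick k b ⊔ (tick b a ⊔ tick b d) , tick b d)
  ∎

whirl-InF : ∀ {k} t → InF k t → InF k (whirl k t)
whirl-InF {k} (a , b , d) inF@(_ , _ , b≤k) rewrite whirl-formula a b d inF =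
  m≤n⇒m≤o⊔n (tick k b) (m≤m⊔n (tick b a) (tick b d)) ,
  m≤n⇒m≤o⊔n (tick k b) (m≤n⊔m (tick b a) (tick b d)) ,
  ⊔-lub (tick-≤ k b) (⊔-lub (≤-trans (tick-≤ b a) b≤k) (≤-trans (tick-≤ b d) b≤k))

whirl-swap : ∀ {k} t → InF k t → whirl k (swap t) ≡ swap (whirl k t)
whirl-swap {k} (a , b , d) inF
  rewrite whirl-formula d b a (InF-swap (a , b , d) inF) | whirl-formula a b d inF
  = cong (λ v → tick b d , tick k b ⊔ v , tick b a) (⊔-comm (tick b d) (tick b a))

iterate-whirl-swap : ∀ {k} n t → InF k t →
                     iterate (whirl k) n (swap t) ≡ swap (iterate (whirl k) n t)
iterate-whirl-swap {k} n t =
  iterate-commute (InF k) (whirl k) swap (whirl-InF _) (whirl-swap _) n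

whirl-below : ∀ {k a b d} → a ≤ b → d ≤ b → b < k →
              whirl k (a , b , d) ≡ (tick b a , suc b , tick b d)
whirl-below {a = a} {b} {d} a≤b d≤b b<k =
  trans (whirl-formula a b d (a≤b , d≤b , <⇒≤ b<k))
        (cong (λ v → tick b a , v , tick b d)
              (trans (cong (_⊔ (tick b a ⊔ tick b d)) (tick-< b<k))
                     (m≥n⇒m⊔n≡m (m≤n⇒m≤1+n (⊔-lub (tick-≤ b a) (tick-≤ b d))))))

whirl-top : ∀ {k a b d} → b ≡ k → a ≤ b → d ≤ b →
            whirl k (a , b , d) ≡ (tick b a , tick b a ⊔ tick b d , tick b d)
whirl-top {k} {a} {d = d} refl a≤k d≤k =
  trans (whirl-formula a k d (a≤k , d≤k , ≤-refl))
        (cong (λ v → tick k a , v ⊔ (tick k a ⊔ tick k d) , tick k d) (tick-self k))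

whirl-interior : ∀ {k a b d} → a < b → d < b → b < k →
                 whirl k (a , b , d) ≡ (suc a , suc b , suc d)
whirl-interior {b = b} a<b d<b b<k =
  trans (whirl-below (<⇒≤ a<b) (<⇒≤ d<b) b<k) (cong₂ (λ u v → u , suc b , v) (tick-< a<b) (tick-< d<b))

whirl-summit : ∀ {k T L} → L ≤ T → T < k → whirl k (T , T , L) ≡ (0 , suc T , tick T L)
whirl-summit {T = T} {L} L≤T T<k =
  trans (whirl-below ≤-refl L≤T T<k) (cong (_, suc T , tick T L) (tick-self T))

whirl-from-summit : ∀ n {k T L} → L ≤ T → n + T < k →
                    iterate (whirl k) (suc n) (T , T , L) ≡ (n , suc (n + T) , n + tick T L)
whirl-from-summit zero    L≤T T<k = whirl-summit L≤T T<k
whirl-from-summit (suc n) {T = T} {L} L≤T n+T<k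
  rewrite whirl-from-summit n L≤T (<⇒≤ n+T<k) =
  whirl-interior (s≤s (m≤m+n n T)) (s≤s (+-monoʳ-≤ n (tick-≤ T L))) n+T<k

peak : ℕ → ℕ → Triple
peak low gap = (low + suc gap , low + suc gap , low)

peak-InF : ∀ low gap room {k} → low + suc gap + room ≡ k → InF k (peak low gap)
peak-InF low gap room eq = ≤-refl , m≤m+n low (suc gap) , subst (_ ≤_) eq (m≤m+n _ room)

whirl-peak : ∀ low gap room {k} → low + suc gap + room ≡ k →
             iterate (whirl k) (suc room) (peak low gap) ≡ swap (peak room low)
whirl-peak low gap zero eq =
  trans (whirl-top (trans (sym (+-identityʳ T)) eq) ≤-refl (<⇒≤ low<T))
        (cong₂ (λ u v → u , u ⊔ v , v) (tick-self T) (tick-< low<T))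
  where
  T : ℕ
  T = low + suc gap
  low<T : low < T
  low<T = m<m+n low z<s
whirl-peak low gap (suc n) {k} eq = begin
    whirl k (iterate (whirl k) (suc n) (T , T , low))
  ≡⟨ cong (whirl k) (whirl-from-summit n (<⇒≤ low<T) (≤-reflexive 1+n+T≡k)) ⟩
    whirl k (n , suc (n + T) , n + tick T low)
  ≡⟨ cong (λ v → whirl k (n , suc (n + T) , n + v)) (tick-< low<T) ⟩
    whirl k (n , suc (n + T) , n + suc low)
  ≡⟨ whirl-top 1+n+T≡k (<⇒≤ n<1+n+T) (<⇒≤ n+1+low<1+n+T) ⟩
    (tick (suc (n + T)) n , tick (suc (n + T)) n ⊔ tick (suc (n + T)) (n + suc low) ,
     tick (suc (n + T)) (n + suc low))
  ≡⟨ cong₂ (λ u v → u , u ⊔ v , v) (tick-< n<1+n+T) (tick-< n+1+low<1+n+T) ⟩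
    (suc n , suc n ⊔ suc (n + suc low) , suc (n + suc low))
  ≡⟨ cong (λ v → suc n , v , suc (n + suc low)) (m≤n⇒m⊔n≡n (s≤s (m≤m+n n (suc low)))) ⟩
    (suc n , suc (n + suc low) , suc (n + suc low))
  ∎
  where
  T : ℕ
  T = low + suc gap
  low<T : low < T
  low<T = m<m+n low z<s
  1+n+T≡k : suc (n + T) ≡ k
  1+n+T≡k = trans (cong suc (+-comm n T)) (trans (sym (+-suc T n)) eq)
  n<1+n+T : n < suc (n + T)
  n<1+n+T = s≤s (m≤m+n n T)
  n+1+low<1+n+T : n + suc low < suc (n + T)
  n+1+low<1+n+T = s≤s (+-monoʳ-≤ n low<T)

whirl-diagonal : ∀ m n {k} → m + n ≡ k → iterate (whirl k) (suc n) (m , m , m) ≡ (n , n , n)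
whirl-diagonal m zero eq =
  trans (whirl-top (trans (sym (+-identityʳ m)) eq) ≤-refl ≤-refl)
        (cong (λ u → u , u ⊔ u , u) (tick-self m))
whirl-diagonal m (suc n) {k} eq = begin
    whirl k (iterate (whirl k) (suc n) (m , m , m))
  ≡⟨ cong (whirl k) (whirl-from-summit n ≤-refl (≤-reflexive 1+n+m≡k)) ⟩
    whirl k (n , suc (n + m) , n + tick m m)
  ≡⟨ cong (λ v → whirl k (n , suc (n + m) , n + v)) (tick-self m) ⟩
    whirl k (n , suc (n + m) , n + 0)
  ≡⟨ cong (λ v → whirl k (n , suc (n + m) , v)) (+-identityʳ n) ⟩
    whirl k (n , suc (n + m) , n)
  ≡⟨ whirl-top 1+n+m≡k (<⇒≤ n<1+n+m) (<⇒≤ n<1+n+m) ⟩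
    (tick (suc (n + m)) n , tick (suc (n + m)) n ⊔ tick (suc (n + m)) n , tick (suc (n + m)) n)
  ≡⟨ cong (λ u → u , u ⊔ u , u) (tick-< n<1+n+m) ⟩
    (suc n , suc n ⊔ suc n , suc n)
  ≡⟨ cong (λ v → suc n , v , suc n) (⊔-idem (suc n)) ⟩
    (suc n , suc n , suc n)
  ∎
  where
  1+n+m≡k : suc (n + m) ≡ k
  1+n+m≡k = trans (cong suc (+-comm n m)) (trans (sym (+-suc m n)) eq)
  n<1+n+m : n < suc (n + m)
  n<1+n+m = s≤s (m≤m+n n m)

HalfTurn : ℕ → Triple → Set
HalfTurn k t = iterate (whirl k) (k + 2) t ≡ swap t

halfTurn-whirl : ∀ {k s t} → InF k s → whirl k s ≡ t → HalfTurn k s → HalfTurn k t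
halfTurn-whirl {k} {s} inF refl half = begin
    iterate (whirl k) (k + 2) (whirl k s)
  ≡⟨ sym (iterate-suc (whirl k) (k + 2) s) ⟩
    whirl k (iterate (whirl k) (k + 2) s)
  ≡⟨ cong (whirl k) half ⟩
    whirl k (swap s)
  ≡⟨ whirl-swap s inF ⟩
    swap (whirl k s)
  ∎

halfTurn-swap : ∀ {k t} → InF k t → HalfTurn k t → HalfTurn k (swap t)
halfTurn-swap {k} {t} inF half =
  trans (iterate-whirl-swap (k + 2) t inF) (cong swap half)

halfTurn-peak : ∀ low gap room {k} → low + suc gap + room ≡ k → HalfTurn k (peak low gap)
halfTurn-peak low gap room {k} eq = begin
    iterate (whirl k) (k + 2) p₀
  ≡⟨ cong (λ n → iterate (whirl k) n p₀) (trans (cong (_+ 2) (sym eq)) (period low gap room)) ⟩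
    iterate (whirl k) (suc low + (suc gap + suc room)) p₀
  ≡⟨ trans (iterate-+ (whirl k) (suc low) _ p₀)
           (cong (iterate (whirl k) (suc low)) (iterate-+ (whirl k) (suc gap) (suc room) p₀)) ⟩
    iterate (whirl k) (suc low) (iterate (whirl k) (suc gap) (iterate (whirl k) (suc room) p₀))
  ≡⟨ cong (iterate (whirl k) (suc low) ∘ iterate (whirl k) (suc gap)) (whirl-peak low gap room eq) ⟩
    iterate (whirl k) (suc low) (iterate (whirl k) (suc gap) (swap p₁))
  ≡⟨ cong (iterate (whirl k) (suc low)) (iterate-whirl-swap (suc gap) p₁ (peak-InF room low gap eq₁)) ⟩
    iterate (whirl k) (suc low) (swap (iterate (whirl k) (suc gap) p₁))
  ≡⟨ cong (iterate (whirl k) (suc low) ∘ swap) (whirl-peak room low gap eq₁) ⟩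
    iterate (whirl k) (suc low) (swap (swap p₂))
  ≡⟨ cong (iterate (whirl k) (suc low)) (swap-involutive p₂) ⟩
    iterate (whirl k) (suc low) p₂
  ≡⟨ whirl-peak gap room low (trans (sym (rotate room low gap)) eq₁) ⟩
    swap p₀
  ∎
  where
  open +-*-Solver using (solve; _:+_; _:=_; con)
  p₀ p₁ p₂ : Triple
  p₀ = peak low gap
  p₁ = peak room low
  p₂ = peak gap room
  rotate : ∀ x y z → x + suc y + z ≡ z + suc x + y
  rotate = solve 3 (λ x y z → x :+ (con 1 :+ y) :+ z := z :+ (con 1 :+ x) :+ y) refl
  period : ∀ x y z → x + suc y + z + 2 ≡ suc x + (suc y + suc z)
  period = solve 3 (λ x y z → x :+ (con 1 :+ y) :+ z :+ con 2
                            := (con 1 :+ x) :+ ((con 1 :+ y) :+ (con 1 :+ z))) refl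
  eq₁ : room + suc low + gap ≡ k
  eq₁ = trans (sym (rotate low gap room)) eq

halfTurn-diagonal : ∀ {k m} → m ≤ k → HalfTurn k (m , m , m)
halfTurn-diagonal {k} {m} m≤k with m≤n⇒∃[o]m+o≡n m≤k
... | n , eq = begin
    iterate (whirl k) (k + 2) (m , m , m)
  ≡⟨ cong (λ j → iterate (whirl k) j (m , m , m)) (trans (cong (_+ 2) (sym eq)) (period m n)) ⟩
    iterate (whirl k) (suc m + suc n) (m , m , m)
  ≡⟨ iterate-+ (whirl k) (suc m) (suc n) (m , m , m) ⟩
    iterate (whirl k) (suc m) (iterate (whirl k) (suc n) (m , m , m))
  ≡⟨ cong (iterate (whirl k) (suc m)) (whirl-diagonal m n eq) ⟩
    iterate (whirl k) (suc m) (n , n , n)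
  ≡⟨ whirl-diagonal n m (trans (+-comm n m) eq) ⟩
    (m , m , m)
  ∎
  where
  open +-*-Solver using (solve; _:+_; _:=_; con)
  period : ∀ x y → x + y + 2 ≡ suc x + suc y
  period = solve 2 (λ x y → x :+ y :+ con 2 := (con 1 :+ x) :+ (con 1 :+ y)) refl

halfTurn-summit : ∀ {k T L} → L < T → T ≤ k → HalfTurn k (T , T , L)
halfTurn-summit {k} {L = L} L<T T≤k with m≤n⇒∃[o]m+o≡n L<T
... | gap , refl with m≤n⇒∃[o]m+o≡n T≤k
...   | room , eq =
  subst (λ T → HalfTurn k (T , T , L)) (+-suc L gap)
        (halfTurn-peak L gap room (trans (cong (_+ room) (+-suc L gap)) eq))

halfTurn-after-summit : ∀ {k y z} → z < y → y < k → HalfTurn k (0 , suc y , suc z)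
halfTurn-after-summit {y = y} z<y y<k =
  halfTurn-whirl (≤-refl , <⇒≤ z<y , <⇒≤ y<k)
                 (trans (whirl-summit (<⇒≤ z<y) y<k) (cong (λ v → 0 , suc y , v) (tick-< z<y)))
                 (halfTurn-summit z<y (<⇒≤ y<k))

halfTurn-interior : ∀ {k} x y z → x < y → z < y → y ≤ k → HalfTurn k (x , y , z)
halfTurn-interior zero (suc y) zero _ _ y<k =
  halfTurn-whirl (≤-refl , ≤-refl , <⇒≤ y<k)
                 (trans (whirl-summit ≤-refl y<k) (cong (λ v → 0 , suc y , v) (tick-self y)))
                 (halfTurn-diagonal (<⇒≤ y<k))
halfTurn-interior zero (suc y) (suc z) _ (s≤s z<y) y<k = halfTurn-after-summit z<y y<k
halfTurn-interior (suc x) (suc y) zero (s≤s x<y) _ y<k =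
  halfTurn-swap (z≤n , m≤n⇒m≤1+n x<y , y<k) (halfTurn-after-summit x<y y<k)
halfTurn-interior (suc x) (suc y) (suc z) (s≤s x<y) (s≤s z<y) y<k =
  halfTurn-whirl (<⇒≤ x<y , <⇒≤ z<y , <⇒≤ y<k) (whirl-interior x<y z<y y<k)
                 (halfTurn-interior x y z x<y z<y (<⇒≤ y<k))

halfTurn : ∀ {k} x y z → InF k (x , y , z) → HalfTurn k (x , y , z)
halfTurn x y z (x≤y , z≤y , y≤k) with m≤n⇒m<n∨m≡n x≤y | m≤n⇒m<n∨m≡n z≤y
... | inj₁ x<y  | inj₁ z<y  = halfTurn-interior x y z x<y z<y y≤k
... | inj₂ refl | inj₁ z<y  = halfTurn-summit z<y y≤k
... | inj₁ x<y  | inj₂ refl = halfTurn-swap (≤-refl , <⇒≤ x<y , y≤k) (halfTurn-summit x<y y≤k)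
... | inj₂ refl | inj₂ refl = halfTurn-diagonal y≤k

theorem3p15 : (k : ℕ) → 1 ≤ k → (x y z : ℕ) → x ≤ y → z ≤ y → y ≤ k →
              iterate (whirl k) (k + 2) (x , y , z) ≡ (z , y , x)
theorem3p15 k _ x y z x≤y z≤y y≤k = halfTurn x y z (x≤y , z≤y , y≤k)
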